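{- Let $G_1$ and $G_2$ be disjoint simple graphs of orders $m\geq 1$ and $n\geq 2$, respectively, such that $G_2$ has a Hamiltonian path, and let $G=G_1+G_2$. If $m\leq 2(n-1)$, then the complete double vertex graph $M_2(G)$ is Hamiltonian.
   Context: For a graph $G$, the complete double vertex graph $M_2(G)$ is the graph whose vertices are all $2$-multisubsets of $V(G)$ (i.e., unordered pairs $\{x,y\}$ with $x,y\in V(G)$, where $x=y$ is allowed), and two such vertices are adjacent if their symmetric difference as multisets is a pair $\{a,b\}$ of vertices with $ab\in E(G)$. For disjoint graphs $G_1,G_2$, the join $G_1+G_2$ has vertex set $V(G_1)\cup V(G_2)$ and edge set $E(G_1)\cup E(G_2)\cup\{xy: x\in V(G_1), y\in V(G_2)\}$. -}

module Defs where

open import Data.Nat using (ℕ; suc; _+_; _*_; _≤_; _≥_)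
open import Data.Fin using (Fin; _↑ˡ_; _↑ʳ_; splitAt) renaming (_≤_ to _≤ᶠ_)
open import Data.Sum using (_⊎_; inj₁; inj₂)
open import Data.Product using (Σ; ∃; _×_; _,_; proj₁; proj₂)
open import Data.Unit using (⊤)
open import Data.Empty using (⊥)
open import Data.List using (List; length; []; _∷_)
open import Data.List.Membership.Propositional using (_∈_)
open import Data.List.Relation.Unary.Unique.Propositional using (Unique)
open import Relation.Binary.PropositionalEquality using (_≡_)
open import Relation.Nullary using (¬_)
open import Level using (0ℓ) renaming (suc to lsuc)

record SimpleGraph (n : ℕ) : Set₁ where
  field
    Adj   : Fin n → Fin n → Set
    sym   : ∀ {x y} → Adj x y → Adj y x
    irrefl : ∀ {x} → ¬ Adj x x
open SimpleGraph public

Consecutive : {V : Set} → (V → V → Set) → List V → Set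
Consecutive R []           = ⊤
Consecutive R (x ∷ [])     = ⊤
Consecutive R (x ∷ y ∷ xs) = R x y × Consecutive R (y ∷ xs)

last′ : {V : Set} → V → List V → V
last′ x []       = x
last′ x (y ∷ ys) = last′ y ys

HamiltonianPath : (V : Set) → (V → V → Set) → Set
HamiltonianPath V R =
  Σ (List V) λ p → Unique p × (∀ v → v ∈ p) × Consecutive R p

HamiltonianCycle : (V : Set) → (V → V → Set) → Set
HamiltonianCycle V R =
  Σ V λ v₀ → Σ (List V) λ rest →
    Unique (v₀ ∷ rest) × (∀ v → v ∈ (v₀ ∷ rest)) × length rest ≥ 2 ×
    Consecutive R (v₀ ∷ rest) × R (last′ v₀ rest) v₀

Hamiltonian : {N : ℕ} → SimpleGraph N → Set
Hamiltonian {N} G = HamiltonianCycle (Fin N) (Adj G)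

HasHamiltonianPath : {N : ℕ} → SimpleGraph N → Set
HasHamiltonianPath {N} G = HamiltonianPath (Fin N) (Adj G)

JoinAdj : {m n : ℕ} → SimpleGraph m → SimpleGraph n → Fin (m + n) → Fin (m + n) → Set
JoinAdj {m} {n} G₁ G₂ x y with splitAt m x | splitAt m y
... | inj₁ a | inj₁ b = Adj G₁ a b
... | inj₂ a | inj₂ b = Adj G₂ a b
... | inj₁ _ | inj₂ _ = ⊤
... | inj₂ _ | inj₁ _ = ⊤

JoinAdj-sym : {m n : ℕ} (G₁ : SimpleGraph m) (G₂ : SimpleGraph n) →
  ∀ {x y} → JoinAdj G₁ G₂ x y → JoinAdj G₁ G₂ y x
JoinAdj-sym {m} G₁ G₂ {x} {y} h with splitAt m x | splitAt m y
... | inj₁ a | inj₁ b = sym G₁ h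
... | inj₂ a | inj₂ b = sym G₂ h
... | inj₁ _ | inj₂ _ = _
... | inj₂ _ | inj₁ _ = _

JoinAdj-irrefl : {m n : ℕ} (G₁ : SimpleGraph m) (G₂ : SimpleGraph n) →
  ∀ {x} → ¬ JoinAdj G₁ G₂ x x
JoinAdj-irrefl {m} G₁ G₂ {x} h with splitAt m x
... | inj₁ a = irrefl G₁ h
... | inj₂ a = irrefl G₂ h

join : {m n : ℕ} → SimpleGraph m → SimpleGraph n → SimpleGraph (m + n)
join G₁ G₂ = record
  { Adj = JoinAdj G₁ G₂
  ; sym = JoinAdj-sym G₁ G₂
  ; irrefl = JoinAdj-irrefl G₁ G₂
  }

-- 2-multisubsets of Fin N, represented canonically as pairs (x , y) with x ≤ y.
Multiset2 : ℕ → Set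
Multiset2 N = Σ (Fin N × Fin N) λ p → proj₁ p ≤ᶠ proj₂ p

_≈ₘ_ : {N : ℕ} → Fin N × Fin N → Fin N × Fin N → Set
(x , y) ≈ₘ (u , v) = (x ≡ u × y ≡ v) ⊎ (x ≡ v × y ≡ u)

-- Adjacency in M₂(G): the multiset symmetric difference of A and B is {a, b}
-- with ab ∈ E(G). Since |A| = |B| = 2, this means A = {c, a} and B = {c, b}
-- for some vertex c and an edge ab of G.
M2Adj : {N : ℕ} → SimpleGraph N → Multiset2 N → Multiset2 N → Set
M2Adj G (A , _) (B , _) =
  ∃ λ c → ∃ λ a → ∃ λ b → Adj G a b × A ≈ₘ (c , a) × B ≈ₘ (c , b)

M2Hamiltonian : {N : ℕ} → SimpleGraph N → Set
M2Hamiltonian {N} G = HamiltonianCycle (Multiset2 N) (M2Adj G)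

-- Only the join edges and the Hamiltonian path v 0 — v 1 — ⋯ — v (n ∸ 1) of G₂ are needed, so it
-- suffices to find a Hamiltonian cycle of M₂ of the model graph: an edgeless graph on u 0, …, u (m ∸ 1)
-- joined to that path. Its image under a vertex bijection onto G₁ + G₂ is a Hamiltonian cycle of
-- M₂(G₁ + G₂), since M₂ is monotone in the edges.
--
-- The model cycle is built by induction: explicit cycles for m = 1 and m = 2 (any n ≥ 2), and a
-- step (m, n) ↦ (m + 2, n + 1) that cuts the cycle at its closing edge {u 0, u i} — {u 0, v 0} and
-- splices in a path through exactly the new 2-multisets, those containing u m, u (m + 1) or v n.
-- Starting from (1, k + 2) or (2, k + 2) this reaches every m ≤ 2 (n ∸ 1). Rather than proving the
-- cycle has no repetitions, each stage records that the closed walk passes through every 2-multiset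
-- and has length N (N + 1) / 2, their number; pigeonhole then excludes repetitions.

module Submission where

open import Data.Empty using (⊥; ⊥-elim)
open import Data.Fin as Fin using (Fin; toℕ; fromℕ<; _↑ˡ_; _↑ʳ_; splitAt) renaming (_≤_ to _≤ᶠ_)
import Data.Fin.Properties as Finₚ
open import Data.List using (List; []; _∷_; _++_; length; map; upTo; allFin)
open import Data.List.Properties using (length-++; length-map; length-upTo; length-tabulate)
open import Data.List.Membership.Propositional using (_∈_; _∉_)
open import Data.List.Membership.Propositional.Properties
  using (∈-++⁺ˡ; ∈-++⁺ʳ; ∈-++⁻; ∈-map⁺; ∈-map⁻; ∈-upTo⁻; ∈-allFin)
open import Data.List.Relation.Binary.Subset.Propositional using (_⊆_)
import Data.List.Relation.Unary.All as All
open import Data.List.Relation.Unary.All.Properties.Core using (¬Any⇒All¬)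
open import Data.List.Relation.Unary.AllPairs using ([]; _∷_)
open import Data.List.Relation.Unary.Any as Any using (Any; here; there)
import Data.List.Relation.Unary.Any.Properties as Anyₚ
open import Data.List.Relation.Unary.Unique.Propositional using (Unique)
import Data.List.Relation.Unary.Unique.Propositional.Properties as Uniqueₚ
open import Data.Nat using (ℕ; zero; suc; _+_; _*_; _∸_; _≤_; _<_; _≥_; z≤n; s≤s; s≤s⁻¹)
open import Data.Nat.Properties
open import Data.Nat.DivMod using (_mod_; m<n⇒m%n≡m)
open import Data.Nat.Solver using (module +-*-Solver)
open import Data.Product using (∃; _×_; _,_; proj₁; proj₂)
import Data.Product.Properties as Productₚ
open import Data.Sum using (_⊎_; inj₁; inj₂)
open import Data.Unit using (⊤; tt)
open import Relation.Binary.Definitions using (DecidableEquality; tri<; tri≈; tri>)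
open import Relation.Binary.PropositionalEquality
  using (_≡_; _≢_; refl; sym; trans; cong; cong₂; subst; subst₂; module ≡-Reasoning)
open import Relation.Nullary using (¬_; yes; no)

open import Defs
  using (SimpleGraph; Adj; Consecutive; last′; join; Multiset2; _≈ₘ_; M2Adj;
         HasHamiltonianPath; M2Hamiltonian)

module _ {V : Set} (R : V → V → Set) where

  Chain : V → List V → Set
  Chain x []       = ⊤
  Chain x (y ∷ ys) = R x y × Chain y ys

  chain-++ : ∀ {x y} xs {ys} → Chain x xs → last′ x xs ≡ y → Chain y ys → Chain x (xs ++ ys)
  chain-++ []       _        refl c = c
  chain-++ (y ∷ xs) (r , c₁) eq   c = r , chain-++ xs c₁ eq c

  chain⇒consecutive : ∀ x xs → Chain x xs → Consecutive R (x ∷ xs)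
  chain⇒consecutive x []       _       = tt
  chain⇒consecutive x (y ∷ ys) (r , c) = r , chain⇒consecutive y ys c

chain-map : ∀ {V W : Set} {R : V → V → Set} {S : W → W → Set} (f : V → W) →
  (∀ {a b} → R a b → S (f a) (f b)) → ∀ x xs → Chain R x xs → Chain S (f x) (map f xs)
chain-map f h x []       _       = tt
chain-map f h x (y ∷ ys) (r , c) = h r , chain-map f h y ys c

module _ {V : Set} where

  last′-++ : ∀ (x : V) xs ys → last′ x (xs ++ ys) ≡ last′ (last′ x xs) ys
  last′-++ x []       ys = refl
  last′-++ x (y ∷ xs) ys = last′-++ y xs ys

  last′-++-∷ : ∀ (x : V) xs y ys → last′ x (xs ++ y ∷ ys) ≡ last′ y ys
  last′-++-∷ x []       y ys = refl
  last′-++-∷ x (z ∷ xs) y ys = last′-++-∷ z xs y ys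

  last′-map : ∀ {W : Set} (f : V → W) x xs → last′ (f x) (map f xs) ≡ f (last′ x xs)
  last′-map f x []       = refl
  last′-map f x (y ∷ xs) = last′-map f y xs

-- Pigeonhole principle for lists

module _ {A : Set} where

  remove : ∀ {x : A} {zs} → x ∈ zs → List A
  remove {zs = _ ∷ zs} (here _)  = zs
  remove {zs = z ∷ _}  (there p) = z ∷ remove p

  length-remove : ∀ {x : A} {zs} (p : x ∈ zs) → suc (length (remove p)) ≡ length zs
  length-remove (here _)  = refl
  length-remove (there p) = cong suc (length-remove p)

  ∈-remove-Unique : ∀ {x w : A} {zs} (p : x ∈ zs) → w ∈ zs → w ≢ x → w ∈ remove p
  ∈-remove-Unique (here refl) (here refl) w≢x = ⊥-elim (w≢x refl)
  ∈-remove-Unique (here refl) (there q)   w≢x = q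
  ∈-remove-Unique (there p)   (here refl) w≢x = here refl
  ∈-remove-Unique (there p)   (there q)   w≢x = there (∈-remove-Unique p q w≢x)

  ∈-remove⁻ : ∀ {x : A} {zs} (p : x ∈ zs) → remove p ⊆ zs
  ∈-remove⁻ (here _)  q         = there q
  ∈-remove⁻ (there p) (here e)  = here e
  ∈-remove⁻ (there p) (there q) = there (∈-remove⁻ p q)

  ∉-remove : ∀ {x : A} {zs} (p : x ∈ zs) → Unique zs → x ∉ remove p
  ∉-remove (here refl) (x∉zs ∷ _) q         = All.lookup x∉zs q refl
  ∉-remove (there p)   (z∉zs ∷ _) (here e)  = All.lookup z∉zs p (sym e)
  ∉-remove (there p)   (_ ∷ u)    (there q) = ∉-remove p u q

  remove-Unique : ∀ {x : A} {zs} (p : x ∈ zs) → Unique zs → Unique (remove p)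
  remove-Unique (here _)  (_ ∷ u)    = u
  remove-Unique (there p) (z∉zs ∷ u) = All.tabulate (λ q → All.lookup z∉zs (∈-remove⁻ p q)) ∷ remove-Unique p u

  Unique-⊆⇒length≤ : ∀ (ys zs : List A) → Unique ys → ys ⊆ zs → length ys ≤ length zs
  Unique-⊆⇒length≤ []       zs _          _   = z≤n
  Unique-⊆⇒length≤ (y ∷ ys) zs (y∉ys ∷ u) sub =
    subst (suc (length ys) ≤_) (length-remove y∈zs)
      (s≤s (Unique-⊆⇒length≤ ys (remove y∈zs) u
        (λ q → ∈-remove-Unique y∈zs (sub (there q)) (λ e → All.lookup y∉ys q (sym e)))))
    where y∈zs : y ∈ zs
          y∈zs = sub (here refl)

  module _ (_≟_ : DecidableEquality A) where
    open import Data.List.Membership.DecPropositional _≟_ using (_∈?_)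

    short-cover⇒Unique : ∀ (xs ys : List A) → Unique ys → ys ⊆ xs → length xs ≤ length ys → Unique xs
    short-cover⇒Unique []       ys _  _   _   = []
    short-cover⇒Unique (x ∷ xs) ys uy sub len with x ∈? xs
    ... | yes x∈xs = ⊥-elim (too-long (λ q → absorb (sub q)))
      where absorb : ∀ {w} → w ∈ x ∷ xs → w ∈ xs
            absorb (here refl) = x∈xs
            absorb (there r)   = r
            too-long : ys ⊆ xs → ⊥
            too-long ys⊆xs = 1+n≰n (≤-trans len (Unique-⊆⇒length≤ ys xs uy ys⊆xs))
    ... | no x∉xs with x ∈? ys
    ...   | no x∉ys = ⊥-elim (1+n≰n (≤-trans len (Unique-⊆⇒length≤ ys xs uy ys⊆xs)))
      where ys⊆xs : ys ⊆ xs
            ys⊆xs q with sub q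
            ... | here refl = ⊥-elim (x∉ys q)
            ... | there r   = r
    ...   | yes x∈ys = ¬Any⇒All¬ xs x∉xs
                     ∷ short-cover⇒Unique xs (remove x∈ys) (remove-Unique x∈ys uy) rest⊆xs len′
      where rest⊆xs : remove x∈ys ⊆ xs
            rest⊆xs q with sub (∈-remove⁻ x∈ys q)
            ... | here refl = ⊥-elim (∉-remove x∈ys uy q)
            ... | there r   = r
            len′ : length xs ≤ length (remove x∈ys)
            len′ = s≤s⁻¹ (subst (suc (length xs) ≤_) (sym (length-remove x∈ys)) len)

Unique-complete⇒length≡ : ∀ {n} (p : List (Fin n)) → Unique p → (∀ b → b ∈ p) → length p ≡ n
Unique-complete⇒length≡ {n} p p-unique p-complete = ≤-antisym
  (subst (length p ≤_) length-allFin
    (Unique-⊆⇒length≤ p (allFin n) p-unique (λ {w} _ → ∈-allFin w)))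
  (subst (_≤ length p) length-allFin
    (Unique-⊆⇒length≤ (allFin n) p (Uniqueₚ.allFin⁺ n) (λ {w} _ → p-complete w)))
  where length-allFin : length (allFin n) ≡ n
        length-allFin = length-tabulate (λ i → i)

-- The junk value d is returned past the end of the list.
nth : ∀ {A : Set} → A → List A → ℕ → A
nth d []       j       = d
nth d (x ∷ xs) zero    = x
nth d (x ∷ xs) (suc j) = nth d xs j

nth-consecutive : ∀ {A : Set} {R : A → A → Set} d xs → Consecutive R xs →
                  ∀ j → suc j < length xs → R (nth d xs j) (nth d xs (suc j))
nth-consecutive d (x ∷ y ∷ ys) (r , c) zero    _       = r
nth-consecutive d (x ∷ y ∷ ys) (r , c) (suc j) (s≤s p) = nth-consecutive d (y ∷ ys) c j p
nth-consecutive d (x ∷ [])     _       j       (s≤s ())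

∈⇒nth : ∀ {A : Set} (d : A) xs {y} → y ∈ xs → ∃ λ j → j < length xs × nth d xs j ≡ y
∈⇒nth d (x ∷ xs) (here refl) = 0 , s≤s z≤n , refl
∈⇒nth d (x ∷ xs) (there p) with ∈⇒nth d xs p
... | j , j< , e = suc j , s≤s j< , e

triangular : ℕ → ℕ
triangular zero    = zero
triangular (suc k) = suc k + triangular k

sortedPairs : ℕ → List (ℕ × ℕ)
sortedPairs zero    = []
sortedPairs (suc k) = sortedPairs k ++ map (λ i → (i , k)) (upTo (suc k))

∈-sortedPairs⁻ : ∀ k {z} → z ∈ sortedPairs k → proj₁ z ≤ proj₂ z × proj₂ z < k
∈-sortedPairs⁻ (suc k) p with ∈-++⁻ (sortedPairs k) p
... | inj₁ q = proj₁ (∈-sortedPairs⁻ k q) , m<n⇒m<1+n (proj₂ (∈-sortedPairs⁻ k q))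
... | inj₂ q with ∈-map⁻ (λ i → (i , k)) q
...   | i , r , refl = s≤s⁻¹ (∈-upTo⁻ r) , ≤-refl

sortedPairs-unique : ∀ k → Unique (sortedPairs k)
sortedPairs-unique zero    = []
sortedPairs-unique (suc k) =
  Uniqueₚ.++⁺ (sortedPairs-unique k) (Uniqueₚ.map⁺ (λ { refl → refl }) (Uniqueₚ.upTo⁺ (suc k))) disjoint
  where
    disjoint : ∀ {z} → ¬ (z ∈ sortedPairs k × z ∈ map (λ i → (i , k)) (upTo (suc k)))
    disjoint (p , q) with ∈-map⁻ (λ i → (i , k)) q
    ... | i , r , refl = <-irrefl refl (proj₂ (∈-sortedPairs⁻ k p))

length-sortedPairs : ∀ k → length (sortedPairs k) ≡ triangular k
length-sortedPairs zero    = refl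
length-sortedPairs (suc k) =
  trans (length-++ (sortedPairs k))
    (trans (cong₂ _+_ (length-sortedPairs k) (trans (length-map _ (upTo (suc k))) (length-upTo (suc k))))
      (+-comm (triangular k) (suc k)))

covering-short⇒Unique : ∀ {N} (L : List (Multiset2 N)) → (∀ w → w ∈ L) → length L ≤ triangular N →
                        Unique L
covering-short⇒Unique {N} L covers short =
  Uniqueₚ.map⁻ (short-cover⇒Unique (Productₚ.≡-dec _≟_ _≟_) (map toPair L) (sortedPairs N)
    (sortedPairs-unique N) sorted⊆ (subst (_≤ length (sortedPairs N))
      (sym (length-map toPair L)) (subst (length L ≤_) (sym (length-sortedPairs N)) short)))
  where
    toPair : Multiset2 N → ℕ × ℕ
    toPair ((x , y) , _) = toℕ x , toℕ y
    sorted⊆ : sortedPairs N ⊆ map toPair L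
    sorted⊆ {i , j} q = subst (_∈ map toPair L) toPair-w≡ (∈-map⁺ toPair (covers w))
      where
        bounds : i ≤ j × j < N
        bounds = ∈-sortedPairs⁻ N q
        j<N : j < N
        j<N = proj₂ bounds
        i<N : i < N
        i<N = ≤-<-trans (proj₁ bounds) j<N
        w : Multiset2 N
        w = (fromℕ< i<N , fromℕ< j<N) ,
            subst₂ _≤_ (sym (Finₚ.toℕ-fromℕ< i<N)) (sym (Finₚ.toℕ-fromℕ< j<N)) (proj₁ bounds)
        toPair-w≡ : toPair w ≡ (i , j)
        toPair-w≡ = cong₂ _,_ (Finₚ.toℕ-fromℕ< i<N) (Finₚ.toℕ-fromℕ< j<N)

3≤triangular : ∀ s → 3 ≤ s → 3 ≤ triangular s
3≤triangular (suc (suc (suc s))) _ = m≤m+n 3 _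
3≤triangular (suc zero)          (s≤s ())
3≤triangular (suc (suc zero))    (s≤s (s≤s ()))

module _ {N : ℕ} where

  canonical : Fin N → Fin N → Multiset2 N
  canonical x y with x Finₚ.≤? y
  ... | yes x≤y = (x , y) , x≤y
  ... | no  x≰y = (y , x) , <⇒≤ (≰⇒> x≰y)

  canonical-≈ₘ : ∀ x y → proj₁ (canonical x y) ≈ₘ (x , y)
  canonical-≈ₘ x y with x Finₚ.≤? y
  ... | yes _ = inj₁ (refl , refl)
  ... | no  _ = inj₂ (refl , refl)

  canonical-≤ : ∀ x y (x≤y : x ≤ᶠ y) → canonical x y ≡ ((x , y) , x≤y)
  canonical-≤ x y x≤y with x Finₚ.≤? y
  ... | yes x≤y′ = cong ((x , y) ,_) (Finₚ.≤-irrelevant x≤y′ x≤y)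
  ... | no  x≰y  = ⊥-elim (x≰y x≤y)

  canonical-≥ : ∀ x y (x≤y : x ≤ᶠ y) → canonical y x ≡ ((x , y) , x≤y)
  canonical-≥ x y x≤y with y Finₚ.≤? x
  ... | no  _    = cong ((x , y) ,_) (Finₚ.≤-irrelevant _ x≤y)
  ... | yes y≤x with Finₚ.≤-antisym x≤y y≤x
  ...   | refl = cong ((x , x) ,_) (Finₚ.≤-irrelevant y≤x x≤y)

  ≈ₘ-trans : ∀ {a b c : Fin N × Fin N} → a ≈ₘ b → b ≈ₘ c → a ≈ₘ c
  ≈ₘ-trans (inj₁ (refl , refl)) q                    = q
  ≈ₘ-trans (inj₂ (refl , refl)) (inj₁ (refl , refl)) = inj₂ (refl , refl)
  ≈ₘ-trans (inj₂ (refl , refl)) (inj₂ (refl , refl)) = inj₁ (refl , refl)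

module _ {m n : ℕ} (G₁ : SimpleGraph m) (G₂ : SimpleGraph n) where

  join-↑ˡ-↑ʳ : ∀ a b → Adj (join G₁ G₂) (a ↑ˡ n) (m ↑ʳ b)
  join-↑ˡ-↑ʳ a b rewrite Finₚ.splitAt-↑ˡ m a n | Finₚ.splitAt-↑ʳ m n b = tt

  join-↑ʳ-↑ʳ : ∀ {a b} → Adj G₂ a b → Adj (join G₁ G₂) (m ↑ʳ a) (m ↑ʳ b)
  join-↑ʳ-↑ʳ {a} {b} e rewrite Finₚ.splitAt-↑ʳ m n a | Finₚ.splitAt-↑ʳ m n b = e

-- The model graph

-- u i stands for the i-th vertex of G₁ and v j for the j-th vertex on the Hamiltonian path of G₂.
data Label : Set where
  u v : ℕ → Label

Pair : Set
Pair = Label × Label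

_≈_ : Pair → Pair → Set
(x , y) ≈ (x′ , y′) = (x ≡ x′ × y ≡ y′) ⊎ (x ≡ y′ × y ≡ x′)

infix 4 _∈ₘ_
_∈ₘ_ : Pair → List Pair → Set
t ∈ₘ xs = Any (_≈ t) xs

∈⇒∈ₘ : ∀ {w xs} → w ∈ xs → w ∈ₘ xs
∈⇒∈ₘ = Any.map λ { refl → inj₁ (refl , refl) }

swap∈⇒∈ₘ : ∀ {x y xs} → (y , x) ∈ xs → (x , y) ∈ₘ xs
swap∈⇒∈ₘ = Any.map λ { refl → inj₂ (refl , refl) }

∈ₘ-swap : ∀ {x y xs} → (x , y) ∈ₘ xs → (y , x) ∈ₘ xs
∈ₘ-swap = Any.map λ { (inj₁ (e₁ , e₂)) → inj₂ (e₁ , e₂) ; (inj₂ (e₁ , e₂)) → inj₁ (e₁ , e₂) }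

-- The labels are unbounded; only the path edges stop at v (nb ∸ 1).
module Model (nb : ℕ) where

  Edge : Label → Label → Set
  Edge (u _) (u _) = ⊥
  Edge (u _) (v _) = ⊤
  Edge (v _) (u _) = ⊤
  Edge (v a) (v b) = (b ≡ suc a × b < nb) ⊎ (a ≡ suc b × a < nb)

  PairAdj : Pair → Pair → Set
  PairAdj w w′ = ∃ λ c → ∃ λ a → ∃ λ b → Edge a b × w ≈ (c , a) × w′ ≈ (c , b)

  Walk : Pair → List Pair → Set
  Walk = Chain PairAdj

  -- adjˢᵗ: the moved vertex sits on side s of the source and on side t of the target.
  adjʳʳ : ∀ {c a b} → Edge a b → PairAdj (c , a) (c , b)
  adjʳʳ {c} {a} {b} e = c , a , b , e , inj₁ (refl , refl) , inj₁ (refl , refl)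

  adjʳˡ : ∀ {c a b} → Edge a b → PairAdj (c , a) (b , c)
  adjʳˡ {c} {a} {b} e = c , a , b , e , inj₁ (refl , refl) , inj₂ (refl , refl)

  adjˡʳ : ∀ {c a b} → Edge a b → PairAdj (a , c) (c , b)
  adjˡʳ {c} {a} {b} e = c , a , b , e , inj₂ (refl , refl) , inj₁ (refl , refl)

  adjˡˡ : ∀ {c a b} → Edge a b → PairAdj (a , c) (b , c)
  adjˡˡ {c} {a} {b} e = c , a , b , e , inj₂ (refl , refl) , inj₂ (refl , refl)

  edge↑ : ∀ {a} → suc a < nb → Edge (v a) (v (suc a))
  edge↑ p = inj₁ (refl , p)

  edge↓ : ∀ {a} → suc a < nb → Edge (v (suc a)) (v a)
  edge↓ p = inj₂ (refl , p)

ascending : (ℕ → Pair) → ℕ → ℕ → List Pair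
ascending g a zero    = []
ascending g a (suc c) = g a ∷ ascending g (suc a) c

descending : (ℕ → Pair) → ℕ → ℕ → List Pair
descending g a zero    = []
descending g a (suc c) = g (a + c) ∷ descending g a c

length-ascending : ∀ g a c → length (ascending g a c) ≡ c
length-ascending g a zero    = refl
length-ascending g a (suc c) = cong suc (length-ascending g (suc a) c)

length-descending : ∀ g a c → length (descending g a c) ≡ c
length-descending g a zero    = refl
length-descending g a (suc c) = cong suc (length-descending g a c)

<-+0⇒⊥ : ∀ {a j} → a ≤ j → j < a + 0 → ⊥
<-+0⇒⊥ {a} {j} a≤j j<a = <-irrefl refl (<-≤-trans (subst (j <_) (+-identityʳ a) j<a) a≤j)

<-suc-split : ∀ {j k} → j < suc k → j < k ⊎ j ≡ k
<-suc-split p = m≤n⇒m<n∨m≡n (s≤s⁻¹ p)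

≤-suc-split : ∀ {j k} → j ≤ suc k → j ≤ k ⊎ j ≡ suc k
≤-suc-split p with m≤n⇒m<n∨m≡n p
... | inj₁ q = inj₁ (s≤s⁻¹ q)
... | inj₂ e = inj₂ e

∈-ascending : ∀ g a c j → a ≤ j → j < a + c → g j ∈ ascending g a c
∈-ascending g a zero    j a≤j j<a+c = ⊥-elim (<-+0⇒⊥ a≤j j<a+c)
∈-ascending g a (suc c) j a≤j j<a+c with m≤n⇒m<n∨m≡n a≤j
... | inj₂ refl = here refl
... | inj₁ a<j  = there (∈-ascending g (suc a) c j a<j (subst (j <_) (+-suc a c) j<a+c))

∈-descending : ∀ g a c j → a ≤ j → j < a + c → g j ∈ descending g a c
∈-descending g a zero    j a≤j j<a+c = ⊥-elim (<-+0⇒⊥ a≤j j<a+c)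
∈-descending g a (suc c) j a≤j j<a+c with <-suc-split (subst (j <_) (+-suc a c) j<a+c)
... | inj₂ refl = here refl
... | inj₁ j<a+c′ = there (∈-descending g a c j a≤j j<a+c′)

last′-ascending : ∀ x g a c → last′ x (ascending g a (suc c)) ≡ g (a + c)
last′-ascending x g a zero    = cong g (sym (+-identityʳ a))
last′-ascending x g a (suc c) = trans (last′-ascending (g a) g (suc a) c) (cong g (sym (+-suc a c)))

last′-descending : ∀ x g a c → last′ x (descending g a (suc c)) ≡ g a
last′-descending x g a zero    = cong g (+-identityʳ a)
last′-descending x g a (suc c) = last′-descending (g (a + suc c)) g a c

module Runs (nb : ℕ) where
  open Model nb

  walk-ascending : ∀ {x} g a c → PairAdj x (g a) → (∀ j → j < a + c → PairAdj (g j) (g (suc j))) →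
                   Walk x (ascending g a (suc c))
  walk-ascending g a zero    r h = r , tt
  walk-ascending g a (suc c) r h =
    r , walk-ascending g (suc a) c (h a (subst (a <_) (sym (+-suc a c)) (s≤s (m≤m+n a c))))
                       (λ j p → h j (subst (j <_) (sym (+-suc a c)) p))

  walk-descending : ∀ {x} g a c → PairAdj x (g (a + c)) → (∀ j → j < a + c → PairAdj (g (suc j)) (g j)) →
                    Walk x (descending g a (suc c))
  walk-descending g a zero    r h = r , tt
  walk-descending g a (suc c) r h =
    r , walk-descending g a c (subst (λ k → PairAdj (g k) (g (a + c))) (sym (+-suc a c)) (h (a + c) a+c<a+1+c))
                        (λ j p → h j (<-trans p a+c<a+1+c))
    where a+c<a+1+c : a + c < a + suc c
          a+c<a+1+c = subst (a + c <_) (sym (+-suc a c)) ≤-refl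

sweep-block : ℕ → ℕ → List Pair
sweep-block o j = (v (o + j) , v (o + j)) ∷ descending (λ a → (v a , v (suc (o + j)))) o (suc j)

sweep-body : ℕ → ℕ → ℕ → List Pair
sweep-body r o zero    = []
sweep-body r o (suc t) = sweep-body r o t ++ (sweep-block o t ++ (u r , v (suc (o + t))) ∷ [])

sweep-prefix : ℕ → ℕ → ℕ → List Pair
sweep-prefix r o t = (u r , v o) ∷ sweep-body r o t

-- sweep r o t is a Hamiltonian path from {u r, v o} to some {u r, v j} through the pairs
-- {u r, v j} and {v a, v b} with o ≤ a ≤ b ≤ o + t + 1.
sweep′ : ℕ → ℕ → ℕ → List Pair
sweep′ r o zero =
  (v o , v o) ∷ (v o , v (suc o)) ∷ (v (suc o) , v (suc o)) ∷ (u r , v (suc o)) ∷ []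
sweep′ r o (suc t) =
  sweep-body r o t ++ (sweep-block o t ++ (ascending (λ a → (v a , v s₂)) o (suc t) ++
    ((u r , v s₂) ∷ (v s₂ , v s₂) ∷ (v s₁ , v s₂) ∷ (v s₁ , v s₁) ∷ (u r , v s₁) ∷ [])))
  where s₁ s₂ : ℕ
        s₁ = suc (o + t)
        s₂ = suc s₁

sweep : ℕ → ℕ → ℕ → List Pair
sweep r o t = (u r , v o) ∷ sweep′ r o t

last′-sweep-prefix : ∀ x r o t → last′ x (sweep-prefix r o t) ≡ (u r , v (o + t))
last′-sweep-prefix x r o zero    = cong (λ k → (u r , v k)) (sym (+-identityʳ o))
last′-sweep-prefix x r o (suc t) =
  trans (last′-++-∷ x (sweep-prefix r o t) (v (o + t) , v (o + t)) _)
  (trans (last′-++-∷ (v (o + t) , v (suc (o + t))) (descending (λ a → (v a , v (suc (o + t)))) o t)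
                     (u r , v (suc (o + t))) [])
         (cong (λ k → (u r , v k)) (sym (+-suc o t))))

last′-sweep : ∀ x r o t → ∃ λ j → last′ x (sweep r o t) ≡ (u r , v j)
last′-sweep x r o zero    = suc o , refl
last′-sweep x r o (suc t) = suc (o + t) ,
  trans (last′-++-∷ x (sweep-prefix r o t) (v (o + t) , v (o + t)) _)
  (trans (last′-++-∷ (v (o + t) , v (suc (o + t))) (descending (λ a → (v a , v (suc (o + t)))) o t)
                     (v o , v (suc (suc (o + t)))) _)
         (last′-++-∷ (v o , v (suc (suc (o + t)))) (ascending (λ a → (v a , v (suc (suc (o + t))))) (suc o) t)
                     (u r , v (suc (suc (o + t)))) _))

o+3+t≡ : ∀ o t → o + suc (suc (suc t)) ≡ suc (suc (suc (o + t)))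
o+3+t≡ o t = trans (+-suc o _) (cong suc (trans (+-suc o _) (cong suc (+-suc o t))))

module SweepWalk (nb : ℕ) where
  open Model nb
  open Runs nb

  walk-sweep-block : ∀ r o j {ys} → suc (o + j) < nb → Walk (v o , v (suc (o + j))) ys →
                     Walk (u r , v (o + j)) (sweep-block o j ++ ys)
  walk-sweep-block r o j b w =
    adjˡʳ tt ,
    chain-++ PairAdj (descending g o (suc j))
      (walk-descending g o j (adjʳʳ (edge↑ b)) (λ i p → adjˡˡ (edge↓ (<-trans (s≤s p) b))))
      (last′-descending (v (o + j) , v (o + j)) g o j) w
    where g : ℕ → Pair
          g a = (v a , v (suc (o + j)))

  walk-sweep-prefix : ∀ {x} r o t → PairAdj x (u r , v o) → o + t < nb → Walk x (sweep-prefix r o t)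
  walk-sweep-prefix r o zero    a _ = a , tt
  walk-sweep-prefix {x} r o (suc t) a b =
    chain-++ PairAdj (sweep-prefix r o t) (walk-sweep-prefix r o t a b′) (last′-sweep-prefix x r o t)
      (walk-sweep-block r o t b″ (adjˡˡ tt , tt))
    where b″ : suc (o + t) < nb
          b″ = subst (_< nb) (+-suc o t) b
          b′ : o + t < nb
          b′ = <-trans (n<1+n _) b″

  walk-sweep : ∀ {x} r o t → PairAdj x (u r , v o) → o + suc (suc t) ≤ nb → Walk x (sweep r o t)
  walk-sweep r o zero a b =
    a , adjˡʳ tt , adjʳʳ (edge↑ b₁) , adjˡʳ (edge↑ b₁) , adjˡˡ tt , tt
    where b₁ : suc o < nb
          b₁ = subst (_≤ nb) (+-comm o 2) b
  walk-sweep {x} r o (suc t) a b =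
    chain-++ PairAdj (sweep-prefix r o t) (walk-sweep-prefix r o t a b₀) (last′-sweep-prefix x r o t)
      (walk-sweep-block r o t b₁
        (chain-++ PairAdj (ascending g o (suc t))
          (walk-ascending g o t (adjʳʳ (edge↑ b₂)) (λ j p → adjˡˡ (edge↑ (<-trans (s≤s p) b₁))))
          (last′-ascending (v o , v s₁) g o t)
          (adjˡˡ tt , adjˡʳ tt , adjˡˡ (edge↓ b₂) , adjʳʳ (edge↓ b₂) , adjˡˡ tt , tt)))
    where
      s₁ s₂ : ℕ
      s₁ = suc (o + t)
      s₂ = suc s₁
      g : ℕ → Pair
      g a = (v a , v s₂)
      b₂ : s₂ < nb
      b₂ = subst (_≤ nb) (o+3+t≡ o t) b
      b₁ : s₁ < nb
      b₁ = <-trans (n<1+n _) b₂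
      b₀ : o + t < nb
      b₀ = <-trans (n<1+n _) b₁

∈-sweep-prefix-uv : ∀ r o t j → o ≤ j → j ≤ o + t → (u r , v j) ∈ sweep-prefix r o t
∈-sweep-prefix-uv r o zero    j p q with ≤-antisym (subst (j ≤_) (+-identityʳ o) q) p
... | refl = here refl
∈-sweep-prefix-uv r o (suc t) j p q with ≤-suc-split (subst (j ≤_) (+-suc o t) q)
... | inj₁ q′   = ∈-++⁺ˡ (∈-sweep-prefix-uv r o t j p q′)
... | inj₂ refl = ∈-++⁺ʳ (sweep-prefix r o t) (∈-++⁺ʳ (sweep-block o t) (here refl))

∈-sweep-prefix-vv : ∀ r o t a → o ≤ a → a < o + t → (v a , v a) ∈ sweep-prefix r o t
∈-sweep-prefix-vv r o zero    a p q = ⊥-elim (<-+0⇒⊥ p q)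
∈-sweep-prefix-vv r o (suc t) a p q with <-suc-split (subst (a <_) (+-suc o t) q)
... | inj₁ q′   = ∈-++⁺ˡ (∈-sweep-prefix-vv r o t a p q′)
... | inj₂ refl = ∈-++⁺ʳ (sweep-prefix r o t) (∈-++⁺ˡ {xs = sweep-block o t} (here refl))

∈-sweep-prefix-v<v : ∀ r o t a b → o ≤ a → a < b → b ≤ o + t → (v a , v b) ∈ sweep-prefix r o t
∈-sweep-prefix-v<v r o zero    a b p q w = ⊥-elim (<-+0⇒⊥ p (<-≤-trans q w))
∈-sweep-prefix-v<v r o (suc t) a b p q w with ≤-suc-split (subst (b ≤_) (+-suc o t) w)
... | inj₁ w′   = ∈-++⁺ˡ (∈-sweep-prefix-v<v r o t a b p q w′)
... | inj₂ refl = ∈-++⁺ʳ (sweep-prefix r o t) (∈-++⁺ˡ (there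
      (∈-descending (λ a → (v a , v (suc (o + t)))) o (suc t) a p (subst (a <_) (sym (+-suc o t)) q))))

∈-sweep-uv : ∀ r o t j → o ≤ j → j < o + suc (suc t) → (u r , v j) ∈ sweep r o t
∈-sweep-uv r o zero j p q with <-suc-split (subst (j <_) (+-comm o 2) q)
... | inj₂ refl = there (there (there (there (here refl))))
... | inj₁ q′ with ≤-antisym (s≤s⁻¹ q′) p
...   | refl = here refl
∈-sweep-uv r o (suc t) j p q with <-suc-split (subst (j <_) (o+3+t≡ o t) q)
... | inj₂ refl = ∈-++⁺ʳ (sweep-prefix r o t) (∈-++⁺ʳ (sweep-block o t) (∈-++⁺ʳ (ascending _ o (suc t))
                    (here refl)))
... | inj₁ q′ with <-suc-split q′
...   | inj₂ refl = ∈-++⁺ʳ (sweep-prefix r o t) (∈-++⁺ʳ (sweep-block o t) (∈-++⁺ʳ (ascending _ o (suc t))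
                      (there (there (there (there (here refl)))))))
...   | inj₁ q″ = ∈-++⁺ˡ (∈-sweep-prefix-uv r o t j p (s≤s⁻¹ q″))

∈-sweep-vv : ∀ r o t a b → o ≤ a → a ≤ b → b < o + suc (suc t) → (v a , v b) ∈ sweep r o t
∈-sweep-vv r o zero a b p q w with <-suc-split (subst (b <_) (+-comm o 2) w)
... | inj₁ w′ with ≤-antisym (s≤s⁻¹ w′) (≤-trans p q)
...   | refl with ≤-antisym q p
...     | refl = there (here refl)
∈-sweep-vv r o zero a b p q w | inj₂ refl with m≤n⇒m<n∨m≡n q
... | inj₂ refl = there (there (there (here refl)))
... | inj₁ a<b with ≤-antisym (s≤s⁻¹ a<b) p
...   | refl = there (there (here refl))
∈-sweep-vv r o (suc t) a b p q w with <-suc-split (subst (b <_) (o+3+t≡ o t) w)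
... | inj₂ refl with m≤n⇒m<n∨m≡n q
...   | inj₂ refl = ∈-++⁺ʳ (sweep-prefix r o t) (∈-++⁺ʳ (sweep-block o t) (∈-++⁺ʳ (ascending _ o (suc t))
                      (there (here refl))))
...   | inj₁ a<b with <-suc-split a<b
...     | inj₂ refl = ∈-++⁺ʳ (sweep-prefix r o t) (∈-++⁺ʳ (sweep-block o t) (∈-++⁺ʳ (ascending _ o (suc t))
                        (there (there (here refl)))))
...     | inj₁ a<s₁ = ∈-++⁺ʳ (sweep-prefix r o t) (∈-++⁺ʳ (sweep-block o t) (∈-++⁺ˡ
                        (∈-ascending (λ a → (v a , v (suc (suc (o + t))))) o (suc t) a p
                          (subst (a <_) (sym (+-suc o t)) a<s₁))))
∈-sweep-vv r o (suc t) a b p q w | inj₁ w′ with <-suc-split w′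
...   | inj₂ refl with m≤n⇒m<n∨m≡n q
...     | inj₂ refl = ∈-++⁺ʳ (sweep-prefix r o t) (∈-++⁺ʳ (sweep-block o t) (∈-++⁺ʳ (ascending _ o (suc t))
                        (there (there (there (here refl))))))
...     | inj₁ a<b = ∈-++⁺ʳ (sweep-prefix r o t) (∈-++⁺ˡ {xs = sweep-block o t} (there
                       (∈-descending (λ a → (v a , v (suc (o + t)))) o (suc t) a p
                         (subst (a <_) (sym (+-suc o t)) a<b))))
∈-sweep-vv r o (suc t) a b p q w | inj₁ w′ | inj₁ w″ with m≤n⇒m<n∨m≡n q
... | inj₁ a<b = ∈-++⁺ˡ (∈-sweep-prefix-v<v r o t a b p a<b (s≤s⁻¹ w″))
... | inj₂ refl with <-suc-split w″
...   | inj₂ refl = ∈-++⁺ʳ (sweep-prefix r o t) (∈-++⁺ˡ {xs = sweep-block o t} (here refl))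
...   | inj₁ a<o+t = ∈-++⁺ˡ (∈-sweep-prefix-vv r o t a p a<o+t)

open +-*-Solver

length-sweep-prefix : ∀ r o t → length (sweep-prefix r o t) ≡ t + triangular (suc t)
length-sweep-prefix r o zero    = refl
length-sweep-prefix r o (suc t) = begin
  length (sweep-prefix r o t ++ (sweep-block o t ++ (u r , v (suc (o + t))) ∷ []))
    ≡⟨ length-++ (sweep-prefix r o t) ⟩
  length (sweep-prefix r o t) + length (sweep-block o t ++ (u r , v (suc (o + t))) ∷ [])
    ≡⟨ cong₂ _+_ (length-sweep-prefix r o t)
         (trans (length-++ (sweep-block o t)) (cong (λ k → suc k + 1) (length-descending _ o (suc t)))) ⟩
  t + triangular (suc t) + (suc (suc t) + 1)
    ≡⟨ solve 2 (λ t T → t :+ T :+ ((con 2 :+ t) :+ con 1) := (con 1 :+ t) :+ ((con 2 :+ t) :+ T))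
         refl t (triangular (suc t)) ⟩
  suc t + triangular (suc (suc t)) ∎
  where open ≡-Reasoning

length-sweep : ∀ r o t → length (sweep r o t) ≡ suc (suc t) + triangular (suc (suc t))
length-sweep r o zero    = refl
length-sweep r o (suc t) = begin
  length (sweep-prefix r o t ++ (sweep-block o t ++ (ascending g o (suc t) ++ tail)))
    ≡⟨ length-++ (sweep-prefix r o t) ⟩
  length (sweep-prefix r o t) + length (sweep-block o t ++ (ascending g o (suc t) ++ tail))
    ≡⟨ cong (length (sweep-prefix r o t) +_)
         (trans (length-++ (sweep-block o t))
           (cong (length (sweep-block o t) +_) (length-++ (ascending g o (suc t))))) ⟩
  length (sweep-prefix r o t) + (length (sweep-block o t) + (length (ascending g o (suc t)) + 5))
    ≡⟨ cong₂ (λ a b → a + (suc b + (length (ascending g o (suc t)) + 5)))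
         (length-sweep-prefix r o t) (length-descending _ o (suc t)) ⟩
  t + triangular (suc t) + (suc (suc t) + (length (ascending g o (suc t)) + 5))
    ≡⟨ cong (λ z → t + triangular (suc t) + (suc (suc t) + (z + 5))) (length-ascending g o (suc t)) ⟩
  t + triangular (suc t) + (suc (suc t) + (suc t + 5))
    ≡⟨ solve 2 (λ t T → t :+ T :+ ((con 2 :+ t) :+ ((con 1 :+ t) :+ con 5)) :=
          (con 3 :+ t) :+ ((con 3 :+ t) :+ ((con 2 :+ t) :+ T))) refl t (triangular (suc t)) ⟩
  suc (suc (suc t)) + triangular (suc (suc (suc t))) ∎
  where
    open ≡-Reasoning
    s₁ s₂ : ℕ
    s₁ = suc (o + t)
    s₂ = suc s₁
    g : ℕ → Pair
    g a = (v a , v s₂)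
    tail : List Pair
    tail = (u r , v s₂) ∷ (v s₂ , v s₂) ∷ (v s₁ , v s₂) ∷ (v s₁ , v s₁) ∷ (u r , v s₁) ∷ []

InModel : ℕ → ℕ → Label → Set
InModel m n (u i) = i < m
InModel m n (v j) = j < n

-- Repetitions are excluded afterwards by counting. The walk closes since {u 0, u i} and
-- {u 0, v 0} are adjacent.
record ModelCycle (nb m n : ℕ) (R : List Pair) : Set where
  open Model nb
  field
    walk    : Walk (u 0 , v 0) R
    closes  : ∃ λ i → last′ (u 0 , v 0) R ≡ (u 0 , u i)
    covers  : ∀ x y → InModel m n x → InModel m n y → (x , y) ∈ₘ (u 0 , v 0) ∷ R
    length≡ : length ((u 0 , v 0) ∷ R) ≡ triangular (m + n)

covers-vv : ∀ {n} (L : List Pair) → (∀ a b → a ≤ b → b < n → (v a , v b) ∈ₘ L) →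
            ∀ a b → a < n → b < n → (v a , v b) ∈ₘ L
covers-vv L h a b p q with ≤-total a b
... | inj₁ a≤b = h a b a≤b q
... | inj₂ b≤a = ∈ₘ-swap (h b a b≤a p)

cycle₁ : ℕ → List Pair
cycle₁ t = sweep′ 0 0 t ++ (u 0 , u 0) ∷ []

modelCycle₁ : ∀ nb t → suc (suc t) ≤ nb → ModelCycle nb 1 (suc (suc t)) (cycle₁ t)
modelCycle₁ nb t b = record
  { walk    = chain-++ PairAdj (sweep′ 0 0 t) (proj₂ (walk-sweep {u 0 , u 0} 0 0 t (adjʳʳ tt) b))
                (proj₂ (last′-sweep (u 0 , u 0) 0 0 t)) (adjʳʳ tt , tt)
  ; closes  = 0 , last′-++-∷ (u 0 , v 0) (sweep′ 0 0 t) (u 0 , u 0) []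
  ; covers  = cover
  ; length≡ = trans (length-++ (sweep 0 0 t))
                (trans (cong (_+ 1) (length-sweep 0 0 t))
                  (solve 2 (λ n T → n :+ T :+ con 1 := (con 1 :+ n) :+ T) refl n (triangular n)))
  }
  where
    open Model nb
    open SweepWalk nb
    n : ℕ
    n = suc (suc t)
    in-sweep : ∀ {w} → w ∈ sweep 0 0 t → w ∈ₘ (u 0 , v 0) ∷ cycle₁ t
    in-sweep p = ∈⇒∈ₘ (∈-++⁺ˡ p)
    cover : ∀ x y → InModel 1 n x → InModel 1 n y → (x , y) ∈ₘ (u 0 , v 0) ∷ cycle₁ t
    cover (u i) (u k) p q rewrite n<1⇒n≡0 p | n<1⇒n≡0 q = ∈⇒∈ₘ (∈-++⁺ʳ (sweep 0 0 t) (here refl))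
    cover (u i) (v j) p q rewrite n<1⇒n≡0 p = in-sweep (∈-sweep-uv 0 0 t j z≤n q)
    cover (v j) (u i) p q rewrite n<1⇒n≡0 q = ∈ₘ-swap (in-sweep (∈-sweep-uv 0 0 t j z≤n p))
    cover (v a) (v b) p q =
      covers-vv _ (λ a b a≤b b<n → in-sweep (∈-sweep-vv 0 0 t a b z≤n a≤b b<n)) a b p q

cycle₂ : ℕ → List Pair
cycle₂ zero =
  (u 0 , u 0) ∷ (u 0 , v 1) ∷ (v 1 , v 1) ∷ (v 0 , v 1) ∷ (v 0 , v 0) ∷
  (u 1 , v 0) ∷ (u 1 , u 1) ∷ (u 1 , v 1) ∷ (u 0 , u 1) ∷ []
cycle₂ (suc t) =
  (u 0 , u 0) ∷ (ascending (λ j → (u 0 , v j)) 1 (suc (suc t)) ++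
    (descending (λ b → (v 0 , v b)) 0 (suc (suc (suc t))) ++
      ((u 1 , v 0) ∷ (u 1 , u 1) ∷ (sweep 1 1 t ++ (u 0 , u 1) ∷ []))))

modelCycle₂-small : ∀ nb → 2 ≤ nb → ModelCycle nb 2 2 (cycle₂ 0)
modelCycle₂-small nb b = record
  { walk    = adjʳʳ tt , adjʳʳ tt , adjˡʳ tt , adjˡˡ (edge↓ b) , adjʳʳ (edge↓ b) ,
              adjʳˡ tt , adjʳʳ tt , adjʳʳ tt , adjʳˡ tt , tt
  ; closes  = 1 , refl
  ; covers  = cover
  ; length≡ = refl
  }
  where
    open Model nb
    cover : ∀ x y → InModel 2 2 x → InModel 2 2 y → (x , y) ∈ₘ (u 0 , v 0) ∷ cycle₂ 0
    cover (u 0) (u 0) _ _ = ∈⇒∈ₘ (there (here refl))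
    cover (u 0) (u 1) _ _ = ∈⇒∈ₘ (there (there (there (there (there (there (there (there (there (here refl))))))))))
    cover (u 1) (u 0) _ _ = swap∈⇒∈ₘ (there (there (there (there (there (there (there (there (there (here refl))))))))))
    cover (u 1) (u 1) _ _ = ∈⇒∈ₘ (there (there (there (there (there (there (there (here refl))))))))
    cover (u 0) (v 0) _ _ = ∈⇒∈ₘ (here refl)
    cover (u 0) (v 1) _ _ = ∈⇒∈ₘ (there (there (here refl)))
    cover (u 1) (v 0) _ _ = ∈⇒∈ₘ (there (there (there (there (there (there (here refl)))))))
    cover (u 1) (v 1) _ _ = ∈⇒∈ₘ (there (there (there (there (there (there (there (there (here refl)))))))))
    cover (v 0) (u 0) _ _ = swap∈⇒∈ₘ (here refl)
    cover (v 1) (u 0) _ _ = swap∈⇒∈ₘ (there (there (here refl)))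
    cover (v 0) (u 1) _ _ = swap∈⇒∈ₘ (there (there (there (there (there (there (here refl)))))))
    cover (v 1) (u 1) _ _ = swap∈⇒∈ₘ (there (there (there (there (there (there (there (there (here refl)))))))))
    cover (v 0) (v 0) _ _ = ∈⇒∈ₘ (there (there (there (there (there (here refl))))))
    cover (v 0) (v 1) _ _ = ∈⇒∈ₘ (there (there (there (there (here refl)))))
    cover (v 1) (v 0) _ _ = swap∈⇒∈ₘ (there (there (there (there (here refl)))))
    cover (v 1) (v 1) _ _ = ∈⇒∈ₘ (there (there (there (here refl))))
    cover (u (suc (suc _))) _ (s≤s (s≤s ())) _
    cover (v (suc (suc _))) _ (s≤s (s≤s ())) _
    cover (u _) (u (suc (suc _))) _ (s≤s (s≤s ()))
    cover (u _) (v (suc (suc _))) _ (s≤s (s≤s ()))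
    cover (v _) (u (suc (suc _))) _ (s≤s (s≤s ()))
    cover (v _) (v (suc (suc _))) _ (s≤s (s≤s ()))

module Cycle₂ (t : ℕ) where
  n : ℕ
  n = suc (suc (suc t))

  g g′ : ℕ → Pair
  g j = (u 0 , v j)
  g′ c = (v 0 , v c)

  R₁ R₂ S T F : List Pair
  R₁ = ascending g 1 (suc (suc t))
  R₂ = descending g′ 0 n
  S = sweep 1 1 t
  T = (u 1 , v 0) ∷ (u 1 , u 1) ∷ (S ++ (u 0 , u 1) ∷ [])
  F = (u 0 , v 0) ∷ cycle₂ (suc t)

  in-R₁ : ∀ {w} → w ∈ R₁ → w ∈ₘ F
  in-R₁ p = ∈⇒∈ₘ (there (there (∈-++⁺ˡ p)))
  in-R₂ : ∀ {w} → w ∈ R₂ → w ∈ₘ F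
  in-R₂ p = ∈⇒∈ₘ (there (there (∈-++⁺ʳ R₁ (∈-++⁺ˡ p))))
  in-T : ∀ {w} → w ∈ T → w ∈ₘ F
  in-T p = ∈⇒∈ₘ (there (there (∈-++⁺ʳ R₁ (∈-++⁺ʳ R₂ p))))
  in-S : ∀ {w} → w ∈ S → w ∈ₘ F
  in-S p = in-T (there (there (∈-++⁺ˡ p)))

  cover-uv : ∀ i j → i < 2 → j < n → (u i , v j) ∈ₘ F
  cover-uv 0       zero    _ _ = ∈⇒∈ₘ (here refl)
  cover-uv 0       (suc j) _ q = in-R₁ (∈-ascending g 1 (suc (suc t)) (suc j) (s≤s z≤n) q)
  cover-uv 1       zero    _ _ = in-T (here refl)
  cover-uv 1       (suc j) _ q = in-S (∈-sweep-uv 1 1 t (suc j) (s≤s z≤n) q)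
  cover-uv (suc (suc _)) _ (s≤s (s≤s ())) _

  cover-vv : ∀ a c → a ≤ c → c < n → (v a , v c) ∈ₘ F
  cover-vv zero    c p q = in-R₂ (∈-descending g′ 0 n c z≤n q)
  cover-vv (suc a) c p q = in-S (∈-sweep-vv 1 1 t (suc a) c (s≤s z≤n) p q)

  covers-cycle₂ : ∀ x y → InModel 2 n x → InModel 2 n y → (x , y) ∈ₘ F
  covers-cycle₂ (u 0) (u 0) _ _ = ∈⇒∈ₘ (there (here refl))
  covers-cycle₂ (u 0) (u 1) _ _ = in-T (there (there (∈-++⁺ʳ S (here refl))))
  covers-cycle₂ (u 1) (u 0) _ _ = ∈ₘ-swap (in-T (there (there (∈-++⁺ʳ S (here refl)))))
  covers-cycle₂ (u 1) (u 1) _ _ = in-T (there (here refl))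
  covers-cycle₂ (u (suc (suc _))) (u _) (s≤s (s≤s ())) _
  covers-cycle₂ (u _) (u (suc (suc _))) _ (s≤s (s≤s ()))
  covers-cycle₂ (u i) (v j) p q = cover-uv i j p q
  covers-cycle₂ (v j) (u i) p q = ∈ₘ-swap (cover-uv i j q p)
  covers-cycle₂ (v a) (v c) p q = covers-vv F cover-vv a c p q

  length-cycle₂ : length F ≡ triangular (2 + n)
  length-cycle₂ = begin
    2 + length (R₁ ++ (R₂ ++ T))
      ≡⟨ cong (2 +_) (length-++ R₁) ⟩
    2 + (length R₁ + length (R₂ ++ T))
      ≡⟨ cong (λ z → 2 + (length R₁ + z)) (length-++ R₂) ⟩
    2 + (length R₁ + (length R₂ + (2 + length (S ++ (u 0 , u 1) ∷ []))))
      ≡⟨ cong (λ z → 2 + (length R₁ + (length R₂ + (2 + z)))) (length-++ S) ⟩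
    2 + (length R₁ + (length R₂ + (2 + (length S + 1))))
      ≡⟨ cong₂ (λ a c → 2 + (a + (c + (2 + (length S + 1)))))
           (length-ascending g 1 (suc (suc t))) (length-descending g′ 0 n) ⟩
    2 + (suc (suc t) + (n + (2 + (length S + 1))))
      ≡⟨ cong (λ z → 2 + (suc (suc t) + (n + (2 + (z + 1))))) (length-sweep 1 1 t) ⟩
    2 + (suc (suc t) + (n + (2 + (suc (suc t) + triangular (suc (suc t)) + 1))))
      ≡⟨ solve 2 (λ t T → con 2 :+ ((con 2 :+ t) :+ ((con 3 :+ t) :+ (con 2 :+ ((con 2 :+ t) :+ T :+ con 1)))) :=
            (con 5 :+ t) :+ ((con 4 :+ t) :+ ((con 3 :+ t) :+ T))) refl t (triangular (suc (suc t))) ⟩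
    triangular (2 + n) ∎
    where open ≡-Reasoning

  module _ (nb : ℕ) (b : n ≤ nb) where
    open Model nb
    open Runs nb
    open SweepWalk nb

    walk : Walk (u 0 , v 0) (cycle₂ (suc t))
    walk = adjʳʳ tt ,
      chain-++ PairAdj R₁ (walk-ascending g 1 (suc t) (adjʳʳ tt) (λ j p → adjʳʳ (edge↑ (≤-trans (s≤s p) b))))
        (last′-ascending (u 0 , u 0) g 1 (suc t))
        (chain-++ PairAdj R₂
          (walk-descending g′ 0 (suc (suc t)) (adjˡˡ tt) (λ j p → adjʳʳ (edge↓ (≤-trans (s≤s p) b))))
          (last′-descending (u 0 , v (suc (suc t))) g′ 0 (suc (suc t)))
          (adjʳˡ tt , adjʳʳ tt ,
            chain-++ PairAdj S (walk-sweep 1 1 t (adjʳʳ tt) b)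
              (proj₂ (last′-sweep (u 1 , u 1) 1 1 t)) (adjʳˡ tt , tt)))

  last′-cycle₂ : last′ (u 0 , v 0) (cycle₂ (suc t)) ≡ (u 0 , u 1)
  last′-cycle₂ = trans (last′-++-∷ (u 0 , u 0) R₁ _ _)
                   (trans (last′-++-∷ (g′ (suc (suc t))) R₂ (u 1 , v 0) _)
                     (last′-++-∷ (u 1 , u 1) S (u 0 , u 1) []))

modelCycle₂-large : ∀ nb t → suc (suc (suc t)) ≤ nb → ModelCycle nb 2 (suc (suc (suc t))) (cycle₂ (suc t))
modelCycle₂-large nb t b = record
  { walk = walk nb b ; closes = 1 , last′-cycle₂ ; covers = covers-cycle₂ ; length≡ = length-cycle₂ }
  where open Cycle₂ t

modelCycle₂ : ∀ nb t → suc (suc t) ≤ nb → ModelCycle nb 2 (suc (suc t)) (cycle₂ t)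
modelCycle₂ nb zero    b = modelCycle₂-small nb b
modelCycle₂ nb (suc t) b = modelCycle₂-large nb t b

-- Extension from (m, n) to (m + 2, n + 1)

-- The pairs that contain one of the new vertices u m, u (m + 1) and v n.
module NewPairs (m n : ℕ) where

  A B C X Y V : ℕ → Pair
  A j = (u m , v j)
  B j = (u (suc m) , v j)
  C i = (u i , v n)
  X i = (u i , u m)
  Y i = (u i , u (suc m))
  V b = (v b , v n)

  AA BB AB : Pair
  AA = (u m , u m)
  BB = (u (suc m) , u (suc m))
  AB = (u m , u (suc m))

  ladder : ℕ → ℕ → ℕ → List Pair
  ladder i j zero    = []
  ladder i j (suc c) =
    Y i ∷ C i ∷ X i ∷ A j ∷ X (suc i) ∷ C (suc i) ∷ Y (suc i) ∷ B j ∷ ladder (suc (suc i)) (suc j) c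

  length-ladder : ∀ i j c → length (ladder i j c) ≡ 8 * c
  length-ladder i j zero    = refl
  length-ladder i j (suc c) = trans (cong (8 +_) (length-ladder (suc (suc i)) (suc j) c)) (sym (*-suc 8 c))

  there⁸ : ∀ {i j w ws} → w ∈ ws →
           w ∈ Y i ∷ C i ∷ X i ∷ A j ∷ X (suc i) ∷ C (suc i) ∷ Y (suc i) ∷ B j ∷ ws
  there⁸ p = there (there (there (there (there (there (there (there p)))))))

  ∈-ladder-XCY : ∀ i j c i′ → i ≤ i′ → i′ < i + 2 * c →
                 (X i′ ∈ ladder i j c) × (C i′ ∈ ladder i j c) × (Y i′ ∈ ladder i j c)
  ∈-ladder-XCY i j zero    i′ p q = ⊥-elim (<-+0⇒⊥ p q)
  ∈-ladder-XCY i j (suc c) i′ p q with m≤n⇒m<n∨m≡n p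
  ... | inj₂ refl = there (there (here refl)) , there (here refl) , here refl
  ... | inj₁ i<i′ with m≤n⇒m<n∨m≡n i<i′
  ...   | inj₂ refl = there (there (there (there (here refl)))) ,
                      there (there (there (there (there (here refl))))) ,
                      there (there (there (there (there (there (here refl))))))
  ...   | inj₁ i+1<i′ with ∈-ladder-XCY (suc (suc i)) (suc j) c i′ i+1<i′ (subst (i′ <_) eq q)
    where eq : i + 2 * suc c ≡ suc (suc i) + 2 * c
          eq = trans (cong (i +_) (*-suc 2 c)) (trans (+-suc i (suc (2 * c))) (cong suc (+-suc i (2 * c))))
  ...     | x , y , z = there⁸ x , there⁸ y , there⁸ z

  ∈-ladder-AB : ∀ i j c j′ → j ≤ j′ → j′ < j + c → (A j′ ∈ ladder i j c) × (B j′ ∈ ladder i j c)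
  ∈-ladder-AB i j zero    j′ p q = ⊥-elim (<-+0⇒⊥ p q)
  ∈-ladder-AB i j (suc c) j′ p q with m≤n⇒m<n∨m≡n p
  ... | inj₂ refl = there (there (there (here refl))) ,
                    there (there (there (there (there (there (there (here refl)))))))
  ... | inj₁ j<j′ with ∈-ladder-AB (suc (suc i)) (suc j) c j′ j<j′ (subst (j′ <_) (+-suc j c) q)
  ...   | x , y = there⁸ x , there⁸ y

  last′-ladder : ∀ i j c k ys y → last′ (B k) (ladder i j c ++ y ∷ ys) ≡ last′ y ys
  last′-ladder i j zero    k ys y = refl
  last′-ladder i j (suc c) k ys y = last′-ladder (suc (suc i)) (suc j) c j ys y

  module LadderWalk (nb : ℕ) where
    open Model nb

    walk-ladder : ∀ i j c k {ys} → (∀ k′ → Walk (B k′) ys) → Walk (B k) (ladder i j c ++ ys)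
    walk-ladder i j zero    k h = h k
    walk-ladder i j (suc c) k h =
      adjʳˡ tt , adjʳʳ tt , adjʳʳ tt , adjˡʳ tt , adjʳˡ tt , adjʳʳ tt , adjʳʳ tt , adjˡʳ tt ,
      walk-ladder (suc (suc i)) (suc j) c j h

record CoversNew (m n : ℕ) (P : List Pair) : Set where
  open NewPairs m n
  field
    covers-X  : ∀ i → i < m → X i ∈ₘ P
    covers-C  : ∀ i → i < m → C i ∈ₘ P
    covers-Y  : ∀ i → i < m → Y i ∈ₘ P
    covers-A  : ∀ j → j ≤ n → A j ∈ₘ P
    covers-B  : ∀ j → j ≤ n → B j ∈ₘ P
    covers-V  : ∀ b → b ≤ n → V b ∈ₘ P
    covers-AA : AA ∈ₘ P
    covers-BB : BB ∈ₘ P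
    covers-AB : AB ∈ₘ P

IsNew : ℕ → ℕ → Label → Set
IsNew m n x = x ≡ u m ⊎ x ≡ u (suc m) ⊎ x ≡ v n

classify : ∀ m n x → InModel (suc (suc m)) (suc n) x → InModel m n x ⊎ IsNew m n x
classify m n (u i) p with <-suc-split p
... | inj₂ refl = inj₂ (inj₂ (inj₁ refl))
... | inj₁ p′ with <-suc-split p′
...   | inj₂ refl = inj₂ (inj₁ refl)
...   | inj₁ p″   = inj₁ p″
classify m n (v j) p with <-suc-split p
... | inj₂ refl = inj₂ (inj₂ (inj₂ refl))
... | inj₁ p′   = inj₁ p′

covers-new : ∀ m n P → CoversNew m n P → ∀ x y → InModel (suc (suc m)) (suc n) y → IsNew m n x →
             (x , y) ∈ₘ P
covers-new m n P cov x (u i) q (inj₁ refl) with <-suc-split q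
... | inj₂ refl = CoversNew.covers-AB cov
... | inj₁ q′ with <-suc-split q′
...   | inj₂ refl = CoversNew.covers-AA cov
...   | inj₁ q″   = ∈ₘ-swap (CoversNew.covers-X cov i q″)
covers-new m n P cov x (v j) q (inj₁ refl) = CoversNew.covers-A cov j (s≤s⁻¹ q)
covers-new m n P cov x (u i) q (inj₂ (inj₁ refl)) with <-suc-split q
... | inj₂ refl = CoversNew.covers-BB cov
... | inj₁ q′ with <-suc-split q′
...   | inj₂ refl = ∈ₘ-swap (CoversNew.covers-AB cov)
...   | inj₁ q″   = ∈ₘ-swap (CoversNew.covers-Y cov i q″)
covers-new m n P cov x (v j) q (inj₂ (inj₁ refl)) = CoversNew.covers-B cov j (s≤s⁻¹ q)
covers-new m n P cov x (u i) q (inj₂ (inj₂ refl)) with <-suc-split q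
... | inj₂ refl = ∈ₘ-swap (CoversNew.covers-B cov n ≤-refl)
... | inj₁ q′ with <-suc-split q′
...   | inj₂ refl = ∈ₘ-swap (CoversNew.covers-A cov n ≤-refl)
...   | inj₁ q″   = ∈ₘ-swap (CoversNew.covers-C cov i q″)
covers-new m n P cov x (v j) q (inj₂ (inj₂ refl)) = ∈ₘ-swap (CoversNew.covers-V cov j (s≤s⁻¹ q))

extend : ∀ nb m n R P → ModelCycle nb m n R →
         (∀ i → Model.Walk nb (u 0 , u i) P) →
         (∀ x → last′ x P ≡ (u 0 , u m)) →
         CoversNew m n P →
         length P + triangular (m + n) ≡ triangular (suc (suc m) + suc n) →
         ModelCycle nb (suc (suc m)) (suc n) (R ++ P)
extend nb m n R P cyc walkP lastP cov lengthP = record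
  { walk    = chain-++ (Model.PairAdj nb) R (ModelCycle.walk cyc) (proj₂ (ModelCycle.closes cyc))
                (walkP (proj₁ (ModelCycle.closes cyc)))
  ; closes  = m , trans (last′-++ (u 0 , v 0) R P) (lastP _)
  ; covers  = cover
  ; length≡ = trans (cong suc (length-++ R)) (trans (+-comm (suc (length R)) (length P))
                (trans (cong (length P +_) (ModelCycle.length≡ cyc)) lengthP))
  }
  where
    cover : ∀ x y → InModel (suc (suc m)) (suc n) x → InModel (suc (suc m)) (suc n) y →
            (x , y) ∈ₘ (u 0 , v 0) ∷ (R ++ P)
    cover x y p q with classify m n x p | classify m n y q
    ... | inj₁ old-x | inj₁ old-y = Anyₚ.++⁺ˡ (ModelCycle.covers cyc x y old-x old-y)
    ... | inj₂ new-x | _          = Anyₚ.++⁺ʳ ((u 0 , v 0) ∷ R) (covers-new m n P cov x y q new-x)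
    ... | inj₁ _     | inj₂ new-y = ∈ₘ-swap (Anyₚ.++⁺ʳ ((u 0 , v 0) ∷ R) (covers-new m n P cov y x p new-y))

-- The ladder pairs off the old vertices u i two at a time, from u 1 when m is odd and from u 2
-- when m is even; the remaining old vertices are visited separately.
module EvenExtension (q k : ℕ) where
  m n : ℕ
  m = suc (suc (q + q))
  n = suc (suc (q + k))
  open NewPairs m n

  S₇ S₆ S₅ S₄ S₃ S₂ S₁ path : List Pair
  S₇ = ascending A (suc (suc q)) (suc k) ++ X 0 ∷ []
  S₆ = AB ∷ A (suc q) ∷ AA ∷ S₇
  S₅ = ascending B (suc q) (suc k) ++ S₆
  S₄ = BB ∷ S₅
  S₃ = ladder 2 1 q ++ S₄
  S₂ = A 0 ∷ X 1 ∷ C 1 ∷ Y 1 ∷ B 0 ∷ S₃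
  S₁ = descending V 0 (suc n) ++ S₂
  path = C 0 ∷ Y 0 ∷ B n ∷ S₁

  in-S₁ : ∀ {w} → w ∈ S₁ → w ∈ₘ path
  in-S₁ p = ∈⇒∈ₘ (there (there (there p)))
  in-S₂ : ∀ {w} → w ∈ S₂ → w ∈ₘ path
  in-S₂ p = in-S₁ (∈-++⁺ʳ (descending V 0 (suc n)) p)
  in-S₃ : ∀ {w} → w ∈ S₃ → w ∈ₘ path
  in-S₃ p = in-S₂ (there (there (there (there (there p)))))
  in-S₄ : ∀ {w} → w ∈ S₄ → w ∈ₘ path
  in-S₄ p = in-S₃ (∈-++⁺ʳ (ladder 2 1 q) p)
  in-S₅ : ∀ {w} → w ∈ S₅ → w ∈ₘ path
  in-S₅ p = in-S₄ (there p)
  in-S₆ : ∀ {w} → w ∈ S₆ → w ∈ₘ path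
  in-S₆ p = in-S₅ (∈-++⁺ʳ (ascending B (suc q) (suc k)) p)
  in-S₇ : ∀ {w} → w ∈ S₇ → w ∈ₘ path
  in-S₇ p = in-S₆ (there (there (there p)))
  in-ladder : ∀ {w} → w ∈ ladder 2 1 q → w ∈ₘ path
  in-ladder p = in-S₃ (∈-++⁺ˡ p)

  ∈-ladder-XCY′ : ∀ i → 2 ≤ i → i < m → (X i ∈ ladder 2 1 q) × (C i ∈ ladder 2 1 q) × (Y i ∈ ladder 2 1 q)
  ∈-ladder-XCY′ i p r =
    ∈-ladder-XCY 2 1 q i p (subst (i <_) (cong (λ z → suc (suc (q + z))) (sym (+-identityʳ q))) r)

  covers-X : ∀ i → i < m → X i ∈ₘ path
  covers-X zero          _ = in-S₇ (∈-++⁺ʳ (ascending A (suc (suc q)) (suc k)) (here refl))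
  covers-X (suc zero)    _ = in-S₂ (there (here refl))
  covers-X (suc (suc i)) r = in-ladder (proj₁ (∈-ladder-XCY′ (suc (suc i)) (s≤s (s≤s z≤n)) r))

  covers-C : ∀ i → i < m → C i ∈ₘ path
  covers-C zero          _ = ∈⇒∈ₘ (here refl)
  covers-C (suc zero)    _ = in-S₂ (there (there (here refl)))
  covers-C (suc (suc i)) r = in-ladder (proj₁ (proj₂ (∈-ladder-XCY′ (suc (suc i)) (s≤s (s≤s z≤n)) r)))

  covers-Y : ∀ i → i < m → Y i ∈ₘ path
  covers-Y zero          _ = ∈⇒∈ₘ (there (here refl))
  covers-Y (suc zero)    _ = in-S₂ (there (there (there (here refl))))
  covers-Y (suc (suc i)) r = in-ladder (proj₂ (proj₂ (∈-ladder-XCY′ (suc (suc i)) (s≤s (s≤s z≤n)) r)))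

  covers-A : ∀ j → j ≤ n → A j ∈ₘ path
  covers-A zero    _ = in-S₂ (here refl)
  covers-A (suc j) p with <-cmp j q
  ... | tri< j<q _ _ = in-ladder (proj₁ (∈-ladder-AB 2 1 q (suc j) (s≤s z≤n) (s≤s j<q)))
  ... | tri≈ _ refl _ = in-S₆ (there (here refl))
  ... | tri> _ _ q<j = in-S₇ (∈-++⁺ˡ (∈-ascending A (suc (suc q)) (suc k) (suc j) (s≤s q<j)
                         (subst (suc j <_) (sym (cong suc (cong suc (+-suc q k)))) (s≤s p))))

  covers-B : ∀ j → j ≤ n → B j ∈ₘ path
  covers-B j p with m≤n⇒m<n∨m≡n p
  ... | inj₂ refl = ∈⇒∈ₘ (there (there (here refl)))
  covers-B zero    p | inj₁ _ = in-S₂ (there (there (there (there (here refl)))))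
  covers-B (suc j) p | inj₁ j<n with <-cmp j q
  ... | tri< j<q _ _ = in-ladder (proj₂ (∈-ladder-AB 2 1 q (suc j) (s≤s z≤n) (s≤s j<q)))
  ... | tri≈ _ refl _ = in-S₅ (∈-++⁺ˡ (∈-ascending B (suc q) (suc k) (suc j) ≤-refl
                          (subst (suc j <_) (sym (cong suc (+-suc q k))) j<n)))
  ... | tri> _ _ q<j = in-S₅ (∈-++⁺ˡ (∈-ascending B (suc q) (suc k) (suc j) (s≤s (<⇒≤ q<j))
                         (subst (suc j <_) (sym (cong suc (+-suc q k))) j<n)))

  covers-V : ∀ b → b ≤ n → V b ∈ₘ path
  covers-V b p = in-S₁ (∈-++⁺ˡ (∈-descending V 0 (suc n) b z≤n (s≤s p)))

  coversNew : CoversNew m n path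
  coversNew = record
    { covers-X = covers-X ; covers-C = covers-C ; covers-Y = covers-Y
    ; covers-A = covers-A ; covers-B = covers-B ; covers-V = covers-V
    ; covers-AA = in-S₆ (there (there (here refl))) ; covers-BB = in-S₄ (here refl)
    ; covers-AB = in-S₆ (here refl)
    }

  last′-path : ∀ x → last′ x path ≡ X 0
  last′-path x =
    trans (last′-++-∷ (B n) (descending V 0 (suc n)) (A 0) _)
    (trans (last′-ladder 2 1 q 0 S₅ BB)
    (trans (last′-++-∷ BB (ascending B (suc q) (suc k)) AB _)
           (last′-++-∷ AA (ascending A (suc (suc q)) (suc k)) (X 0) [])))

  module _ (nb : ℕ) (n<nb : n < nb) where
    open Model nb
    open Runs nb
    open LadderWalk nb

    bounded : ∀ {j} → j < n → suc j < nb
    bounded p = ≤-<-trans p n<nb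

    walk-path : ∀ i → Walk (u 0 , u i) path
    walk-path i =
      adjʳʳ tt , adjʳʳ tt , adjˡʳ tt ,
      chain-++ PairAdj (descending V 0 (suc n))
        (walk-descending V 0 n (adjˡʳ tt) (λ j p → adjˡˡ (edge↓ (bounded p))))
        (last′-descending (B n) V 0 n)
        (adjʳˡ tt , adjʳˡ tt , adjʳʳ tt , adjʳʳ tt , adjˡʳ tt ,
         walk-ladder 2 1 q 0 (λ _ → adjʳʳ tt ,
           chain-++ PairAdj (ascending B (suc q) (suc k))
             (walk-ascending B (suc q) k (adjʳʳ tt) (λ j p → adjʳʳ (edge↑ (bounded (<-trans p (n<1+n _))))))
             (last′-ascending BB B (suc q) k)
             (adjʳˡ tt , adjʳʳ tt , adjʳʳ tt ,
              chain-++ PairAdj (ascending A (suc (suc q)) (suc k))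
                (walk-ascending A (suc (suc q)) k (adjʳʳ tt) (λ j p → adjʳʳ (edge↑ (bounded p))))
                (last′-ascending AA A (suc (suc q)) k)
                (adjʳˡ tt , tt))))

  length-path : length path + triangular (m + n) ≡ triangular (suc (suc m) + suc n)
  length-path = begin
    length path + triangular (m + n)
      ≡⟨ cong (_+ triangular (m + n)) length-S ⟩
    3 + (suc n + (5 + (8 * q + (1 + (suc k + (3 + (suc k + 1))))))) + triangular (m + n)
      ≡⟨ solve 3 (λ q k T → con 3 :+ ((con 3 :+ (q :+ k)) :+ (con 5 :+ (con 8 :* q :+ (con 1 :+
                   ((con 1 :+ k) :+ (con 3 :+ ((con 1 :+ k) :+ con 1))))))) :+ T
             := (con 3 :+ s q k) :+ ((con 2 :+ s q k) :+ ((con 1 :+ s q k) :+ T))) refl q k (triangular (m + n)) ⟩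
    triangular (suc (suc (suc (m + n))))
      ≡⟨ cong (λ z → triangular (suc (suc z))) (sym (+-suc m n)) ⟩
    triangular (suc (suc m) + suc n) ∎
    where
      open ≡-Reasoning
      s = λ q k → (con 2 :+ (q :+ q)) :+ (con 2 :+ (q :+ k))
      length-S₇ : length S₇ ≡ suc k + 1
      length-S₇ = trans (length-++ (ascending A (suc (suc q)) (suc k)))
                    (cong (_+ 1) (length-ascending A (suc (suc q)) (suc k)))
      length-S₅ : length S₅ ≡ suc k + (3 + (suc k + 1))
      length-S₅ = trans (length-++ (ascending B (suc q) (suc k)))
                    (cong₂ _+_ (length-ascending B (suc q) (suc k)) (cong (3 +_) length-S₇))
      length-S₃ : length S₃ ≡ 8 * q + (1 + (suc k + (3 + (suc k + 1))))
      length-S₃ = trans (length-++ (ladder 2 1 q)) (cong₂ _+_ (length-ladder 2 1 q) (cong suc length-S₅))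
      length-S : length path ≡ 3 + (suc n + (5 + (8 * q + (1 + (suc k + (3 + (suc k + 1)))))))
      length-S = cong (3 +_) (trans (length-++ (descending V 0 (suc n)))
                   (cong₂ _+_ (length-descending V 0 (suc n)) (cong (5 +_) length-S₃)))

module OddExtension (q k : ℕ) where
  m n : ℕ
  m = suc (q + q)
  n = suc (suc (q + k))
  open NewPairs m n

  S₆ S₅ S₄ S₃ S₂ S₁ path : List Pair
  S₆ = ascending A (suc q) (suc (suc k)) ++ X 0 ∷ []
  S₅ = AB ∷ A q ∷ AA ∷ S₆
  S₄ = ladder 1 0 q ++ S₅
  S₃ = ascending B (suc q) (suc k) ++ S₄
  S₂ = B n ∷ BB ∷ B q ∷ Y 0 ∷ S₃
  S₁ = ascending V 0 (suc n) ++ S₂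
  path = C 0 ∷ S₁

  in-S₁ : ∀ {w} → w ∈ S₁ → w ∈ₘ path
  in-S₁ p = ∈⇒∈ₘ (there p)
  in-S₂ : ∀ {w} → w ∈ S₂ → w ∈ₘ path
  in-S₂ p = in-S₁ (∈-++⁺ʳ (ascending V 0 (suc n)) p)
  in-S₃ : ∀ {w} → w ∈ S₃ → w ∈ₘ path
  in-S₃ p = in-S₂ (there (there (there (there p))))
  in-S₄ : ∀ {w} → w ∈ S₄ → w ∈ₘ path
  in-S₄ p = in-S₃ (∈-++⁺ʳ (ascending B (suc q) (suc k)) p)
  in-S₅ : ∀ {w} → w ∈ S₅ → w ∈ₘ path
  in-S₅ p = in-S₄ (∈-++⁺ʳ (ladder 1 0 q) p)
  in-S₆ : ∀ {w} → w ∈ S₆ → w ∈ₘ path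
  in-S₆ p = in-S₅ (there (there (there p)))
  in-ladder : ∀ {w} → w ∈ ladder 1 0 q → w ∈ₘ path
  in-ladder p = in-S₄ (∈-++⁺ˡ p)

  ∈-ladder-XCY′ : ∀ i → 1 ≤ i → i < m → (X i ∈ ladder 1 0 q) × (C i ∈ ladder 1 0 q) × (Y i ∈ ladder 1 0 q)
  ∈-ladder-XCY′ i p r = ∈-ladder-XCY 1 0 q i p (subst (i <_) (cong (λ z → suc (q + z)) (sym (+-identityʳ q))) r)

  covers-X : ∀ i → i < m → X i ∈ₘ path
  covers-X zero    _ = in-S₆ (∈-++⁺ʳ (ascending A (suc q) (suc (suc k))) (here refl))
  covers-X (suc i) r = in-ladder (proj₁ (∈-ladder-XCY′ (suc i) (s≤s z≤n) r))

  covers-C : ∀ i → i < m → C i ∈ₘ path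
  covers-C zero    _ = ∈⇒∈ₘ (here refl)
  covers-C (suc i) r = in-ladder (proj₁ (proj₂ (∈-ladder-XCY′ (suc i) (s≤s z≤n) r)))

  covers-Y : ∀ i → i < m → Y i ∈ₘ path
  covers-Y zero    _ = in-S₂ (there (there (there (here refl))))
  covers-Y (suc i) r = in-ladder (proj₂ (proj₂ (∈-ladder-XCY′ (suc i) (s≤s z≤n) r)))

  covers-A : ∀ j → j ≤ n → A j ∈ₘ path
  covers-A j p with <-cmp j q
  ... | tri< j<q _ _ = in-ladder (proj₁ (∈-ladder-AB 1 0 q j z≤n j<q))
  ... | tri≈ _ refl _ = in-S₅ (there (here refl))
  ... | tri> _ _ q<j = in-S₆ (∈-++⁺ˡ (∈-ascending A (suc q) (suc (suc k)) j q<j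
                         (subst (j <_) (sym (cong suc (trans (+-suc q (suc k)) (cong suc (+-suc q k))))) (s≤s p))))

  covers-B : ∀ j → j ≤ n → B j ∈ₘ path
  covers-B j p with m≤n⇒m<n∨m≡n p
  ... | inj₂ refl = in-S₂ (here refl)
  ... | inj₁ j<n with <-cmp j q
  ...   | tri< j<q _ _ = in-ladder (proj₂ (∈-ladder-AB 1 0 q j z≤n j<q))
  ...   | tri≈ _ refl _ = in-S₂ (there (there (here refl)))
  ...   | tri> _ _ q<j = in-S₃ (∈-++⁺ˡ (∈-ascending B (suc q) (suc k) j q<j
                           (subst (j <_) (sym (cong suc (+-suc q k))) j<n)))

  covers-V : ∀ b → b ≤ n → V b ∈ₘ path
  covers-V b p = in-S₁ (∈-++⁺ˡ (∈-ascending V 0 (suc n) b z≤n (s≤s p)))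

  coversNew : CoversNew m n path
  coversNew = record
    { covers-X = covers-X ; covers-C = covers-C ; covers-Y = covers-Y
    ; covers-A = covers-A ; covers-B = covers-B ; covers-V = covers-V
    ; covers-AA = in-S₅ (there (there (here refl))) ; covers-BB = in-S₂ (there (here refl))
    ; covers-AB = in-S₅ (here refl)
    }

  last′-path : ∀ x → last′ x path ≡ X 0
  last′-path x =
    trans (last′-++-∷ (C 0) (ascending V 0 (suc n)) (B n) _)
    (trans (last′-++ (B (suc q)) (ascending B (suc (suc q)) k) S₄)
    (trans (cong (λ z → last′ z S₄) (last′-ascending (Y 0) B (suc q) k))
    (trans (last′-ladder 1 0 q (suc q + k) (A q ∷ AA ∷ S₆) AB)
           (last′-++-∷ AA (ascending A (suc q) (suc (suc k))) (X 0) []))))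

  module _ (nb : ℕ) (n<nb : n < nb) where
    open Model nb
    open Runs nb
    open LadderWalk nb

    bounded : ∀ {j} → j < n → suc j < nb
    bounded p = ≤-<-trans p n<nb

    walk-path : ∀ i → Walk (u 0 , u i) path
    walk-path i =
      adjʳʳ tt ,
      chain-++ PairAdj (ascending V 0 (suc n))
        (walk-ascending V 0 n (adjˡˡ tt) (λ j p → adjˡˡ (edge↑ (bounded p))))
        (last′-ascending (C 0) V 0 n)
        (adjʳˡ tt , adjʳʳ tt , adjʳʳ tt , adjʳˡ tt ,
         chain-++ PairAdj (ascending B (suc q) (suc k))
           (walk-ascending B (suc q) k (adjˡʳ tt) (λ j p → adjʳʳ (edge↑ (bounded (<-trans p (n<1+n _))))))
           (last′-ascending (Y 0) B (suc q) k)
           (walk-ladder 1 0 q (suc q + k) (λ _ →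
              adjʳˡ tt , adjʳʳ tt , adjʳʳ tt ,
              chain-++ PairAdj (ascending A (suc q) (suc (suc k)))
                (walk-ascending A (suc q) (suc k) (adjʳʳ tt)
                  (λ j p → adjʳʳ (edge↑ (bounded (subst (j <_) (cong suc (+-suc q k)) p)))))
                (last′-ascending AA A (suc q) (suc k))
                (adjʳˡ tt , tt))))

  length-path : length path + triangular (m + n) ≡ triangular (suc (suc m) + suc n)
  length-path = begin
    length path + triangular (m + n)
      ≡⟨ cong (_+ triangular (m + n)) length-S ⟩
    1 + (suc n + (4 + (suc k + (8 * q + (3 + (suc (suc k) + 1)))))) + triangular (m + n)
      ≡⟨ solve 3 (λ q k T → con 1 :+ ((con 3 :+ (q :+ k)) :+ (con 4 :+ ((con 1 :+ k) :+ (con 8 :* q :+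
                   (con 3 :+ ((con 2 :+ k) :+ con 1)))))) :+ T
             := (con 3 :+ s q k) :+ ((con 2 :+ s q k) :+ ((con 1 :+ s q k) :+ T))) refl q k (triangular (m + n)) ⟩
    triangular (suc (suc (suc (m + n))))
      ≡⟨ cong (λ z → triangular (suc (suc z))) (sym (+-suc m n)) ⟩
    triangular (suc (suc m) + suc n) ∎
    where
      open ≡-Reasoning
      s = λ q k → (con 1 :+ (q :+ q)) :+ (con 2 :+ (q :+ k))
      length-S₆ : length S₆ ≡ suc (suc k) + 1
      length-S₆ = trans (length-++ (ascending A (suc q) (suc (suc k))))
                    (cong (_+ 1) (length-ascending A (suc q) (suc (suc k))))
      length-S₄ : length S₄ ≡ 8 * q + (3 + (suc (suc k) + 1))
      length-S₄ = trans (length-++ (ladder 1 0 q)) (cong₂ _+_ (length-ladder 1 0 q) (cong (3 +_) length-S₆))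
      length-S₃ : length S₃ ≡ suc k + (8 * q + (3 + (suc (suc k) + 1)))
      length-S₃ = trans (length-++ (ascending B (suc q) (suc k)))
                    (cong₂ _+_ (length-ascending B (suc q) (suc k)) length-S₄)
      length-S : length path ≡ 1 + (suc n + (4 + (suc k + (8 * q + (3 + (suc (suc k) + 1))))))
      length-S = cong suc (trans (length-++ (ascending V 0 (suc n)))
                   (cong₂ _+_ (length-ascending V 0 (suc n)) (cong (4 +_) length-S₃)))

oddCycle : ℕ → ℕ → List Pair
oddCycle zero    k = cycle₁ k
oddCycle (suc q) k = oddCycle q k ++ OddExtension.path q k

evenCycle : ℕ → ℕ → List Pair
evenCycle zero    k = cycle₂ k
evenCycle (suc q) k = evenCycle q k ++ EvenExtension.path q k

oddModelCycle : ∀ nb q k → suc (suc (q + k)) ≤ nb →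
                ModelCycle nb (suc (q + q)) (suc (suc (q + k))) (oddCycle q k)
oddModelCycle nb zero    k b = modelCycle₁ nb k b
oddModelCycle nb (suc q) k b =
  subst (λ z → ModelCycle nb z (suc (suc (suc (q + k)))) (oddCycle (suc q) k))
        (cong (λ z → suc (suc z)) (sym (+-suc q q)))
        (extend nb m n (oddCycle q k) path (oddModelCycle nb q k (≤-trans (n≤1+n _) b))
          (walk-path nb b) last′-path coversNew length-path)
  where open OddExtension q k

evenModelCycle : ∀ nb q k → suc (suc (q + k)) ≤ nb →
                 ModelCycle nb (suc (suc (q + q))) (suc (suc (q + k))) (evenCycle q k)
evenModelCycle nb zero    k b = modelCycle₂ nb k b
evenModelCycle nb (suc q) k b =
  subst (λ z → ModelCycle nb z (suc (suc (suc (q + k)))) (evenCycle (suc q) k))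
        (cong (λ z → suc (suc (suc z))) (sym (+-suc q q)))
        (extend nb m n (evenCycle q k) path (evenModelCycle nb q k (≤-trans (n≤1+n _) b))
          (walk-path nb b) last′-path coversNew length-path)
  where open EvenExtension q k

parity : ∀ m → ∃ λ q → m ≡ q + q ⊎ m ≡ suc (q + q)
parity zero    = 0 , inj₁ refl
parity (suc m) with parity m
... | q , inj₁ e = q , inj₂ (cong suc e)
... | q , inj₂ e = suc q , inj₁ (trans (cong suc e) (cong suc (sym (+-suc q q))))

m+m<n+n⇒m<n : ∀ {a b} → a + a < b + b → a < b
m+m<n+n⇒m<n p = ≰⇒> λ b≤a → <⇒≱ p (+-mono-≤ b≤a b≤a)

q+k+2≡n : ∀ q n′ → q + q < n′ + n′ → suc (suc (q + (suc n′ ∸ suc (suc q)))) ≡ suc n′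
q+k+2≡n q n′ p = m+[n∸m]≡n (s≤s (m+m<n+n⇒m<n p))

modelCycle : ∀ m n → 1 ≤ m → m ≤ 2 * (n ∸ 1) → ∃ λ R → ModelCycle n m n R
modelCycle (suc m′) zero     _ ()
modelCycle (suc m′) (suc n′) _ m≤2[n∸1] with parity m′
... | q , inj₁ refl =
  oddCycle q k , subst (λ n → ModelCycle n (suc (q + q)) n (oddCycle q k)) n≡
                   (oddModelCycle (suc (suc (q + k))) q k ≤-refl)
  where m≤n′+n′ : suc (q + q) ≤ n′ + n′
        m≤n′+n′ = subst (suc (q + q) ≤_) (cong (n′ +_) (+-identityʳ n′)) m≤2[n∸1]
        k = suc n′ ∸ suc (suc q)
        n≡ = q+k+2≡n q n′ m≤n′+n′
... | q , inj₂ refl =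
  evenCycle q k , subst (λ n → ModelCycle n (suc (suc (q + q))) n (evenCycle q k)) n≡
                    (evenModelCycle (suc (suc (q + k))) q k ≤-refl)
  where m≤n′+n′ : suc (suc (q + q)) ≤ n′ + n′
        m≤n′+n′ = subst (suc (suc (q + q)) ≤_) (cong (n′ +_) (+-identityʳ n′)) m≤2[n∸1]
        k = suc n′ ∸ suc (suc q)
        n≡ = q+k+2≡n q n′ (≤-trans (n≤1+n _) m≤n′+n′)

-- From the model to M₂(G)

module FromModel {nb m n : ℕ} (G : SimpleGraph (m + n)) (φ : Label → Fin (m + n))
                 (φ-edge : ∀ {a b} → Model.Edge nb a b → Adj G (φ a) (φ b))
                 (φ-onto : ∀ x → ∃ λ l → InModel m n l × φ l ≡ x) where
  open Model nb

  image : Pair → Multiset2 (m + n)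
  image (a , b) = canonical (φ a) (φ b)

  ≈⇒≈ₘ : ∀ {x y c a} → (x , y) ≈ (c , a) → (φ x , φ y) ≈ₘ (φ c , φ a)
  ≈⇒≈ₘ (inj₁ (refl , refl)) = inj₁ (refl , refl)
  ≈⇒≈ₘ (inj₂ (refl , refl)) = inj₂ (refl , refl)

  image-adj : ∀ {w w′} → PairAdj w w′ → M2Adj G (image w) (image w′)
  image-adj {x , y} {x′ , y′} (c , a , b , e , w≈ , w′≈) =
    φ c , φ a , φ b , φ-edge e ,
    ≈ₘ-trans (canonical-≈ₘ (φ x) (φ y)) (≈⇒≈ₘ w≈) , ≈ₘ-trans (canonical-≈ₘ (φ x′) (φ y′)) (≈⇒≈ₘ w′≈)

  image-onto : ∀ {L} → (∀ x y → InModel m n x → InModel m n y → (x , y) ∈ₘ L) → ∀ w → w ∈ map image L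
  image-onto covers ((x , y) , x≤y) with φ-onto x | φ-onto y
  ... | lx , lx-in , refl | ly , ly-in , refl = Anyₚ.map⁺ (Any.map image≡ (covers lx ly lx-in ly-in))
    where
      image≡ : ∀ {w} → w ≈ (lx , ly) → ((φ lx , φ ly) , x≤y) ≡ image w
      image≡ (inj₁ (refl , refl)) = sym (canonical-≤ (φ lx) (φ ly) x≤y)
      image≡ (inj₂ (refl , refl)) = sym (canonical-≥ (φ lx) (φ ly) x≤y)

  hamiltonian : ∀ {R} → 3 ≤ m + n → ModelCycle nb m n R → M2Hamiltonian G
  hamiltonian {R} 3≤m+n cyc =
    image (u 0 , v 0) , map image R , unique , onto , 2≤length ,
    chain⇒consecutive (M2Adj G) _ (map image R) (chain-map image image-adj _ R walk) ,
    subst (λ z → M2Adj G z (image (u 0 , v 0))) (sym (trans (last′-map image _ R) (cong image closing)))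
      (image-adj (adjʳʳ {u 0} {u i} {v 0} tt))
    where
      open ModelCycle cyc using (walk; closes; length≡) renaming (covers to model-covers)
      i : ℕ
      i = proj₁ closes
      closing : last′ (u 0 , v 0) R ≡ (u 0 , u i)
      closing = proj₂ closes
      onto : ∀ w → w ∈ map image ((u 0 , v 0) ∷ R)
      onto = image-onto model-covers
      length-image : length (map image ((u 0 , v 0) ∷ R)) ≡ triangular (m + n)
      length-image = trans (length-map image ((u 0 , v 0) ∷ R)) length≡
      unique : Unique (map image ((u 0 , v 0) ∷ R))
      unique = covering-short⇒Unique _ onto (≤-reflexive length-image)
      2≤length : length (map image R) ≥ 2
      2≤length = s≤s⁻¹ (subst (3 ≤_) (sym length-image) (3≤triangular (m + n) 3≤m+n))

module JoinLabelling {m′ n : ℕ} (G₁ : SimpleGraph (suc m′)) (G₂ : SimpleGraph n)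
                     (p : List (Fin n)) (p-consecutive : Consecutive (Adj G₂) p)
                     (p-complete : ∀ b → b ∈ p) (length-p : length p ≡ n) (d : Fin n) where
  m : ℕ
  m = suc m′

  -- Only labels satisfying InModel m n matter; the others are mapped arbitrarily.
  φ : Label → Fin (m + n)
  φ (u i) = (i mod m) ↑ˡ n
  φ (v j) = m ↑ʳ nth d p j

  consecutive : ∀ j → suc j < n → Adj G₂ (nth d p j) (nth d p (suc j))
  consecutive j j+1<n = nth-consecutive d p p-consecutive j (subst (suc j <_) (sym length-p) j+1<n)

  φ-edge : ∀ {a b} → Model.Edge n a b → Adj (join G₁ G₂) (φ a) (φ b)
  φ-edge {u i} {v j} _ = join-↑ˡ-↑ʳ G₁ G₂ (i mod m) (nth d p j)
  φ-edge {v j} {u i} _ = SimpleGraph.sym (join G₁ G₂) {φ (u i)} (join-↑ˡ-↑ʳ G₁ G₂ (i mod m) (nth d p j))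
  φ-edge {v a} {v b} (inj₁ (refl , b<n)) = join-↑ʳ-↑ʳ G₁ G₂ (consecutive a b<n)
  φ-edge {v a} {v b} (inj₂ (refl , a<n)) = join-↑ʳ-↑ʳ G₁ G₂ (SimpleGraph.sym G₂ (consecutive b a<n))

  toℕ-mod : ∀ (a : Fin m) → toℕ a mod m ≡ a
  toℕ-mod a = Finₚ.toℕ-injective (trans (Finₚ.toℕ-fromℕ< _) (m<n⇒m%n≡m (Finₚ.toℕ<n a)))

  φ-onto : ∀ x → ∃ λ l → InModel m n l × φ l ≡ x
  φ-onto x with splitAt m x in eq
  ... | inj₁ a = u (toℕ a) , Finₚ.toℕ<n a , trans (cong (_↑ˡ n) (toℕ-mod a)) (Finₚ.splitAt⁻¹-↑ˡ eq)
  ... | inj₂ b with ∈⇒nth d p (p-complete b)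
  ...   | j , j<length , e = v j , subst (j <_) length-p j<length , trans (cong (m ↑ʳ_) e) (Finₚ.splitAt⁻¹-↑ʳ eq)

corollary2 : (m n : ℕ) (G₁ : SimpleGraph m) (G₂ : SimpleGraph n) →
    m ≥ 1 → n ≥ 2 → HasHamiltonianPath G₂ → m ≤ 2 * (n ∸ 1) →
    M2Hamiltonian (join G₁ G₂)
corollary2 (suc m′) (suc n′) G₁ G₂ m≥1 n≥2 (p , p-unique , p-complete , p-consecutive) m≤2[n∸1] =
  FromModel.hamiltonian (join G₁ G₂) φ φ-edge φ-onto (+-mono-≤ m≥1 n≥2)
    (proj₂ (modelCycle (suc m′) (suc n′) m≥1 m≤2[n∸1]))
  where open JoinLabelling G₁ G₂ p p-consecutive p-complete
                           (Unique-complete⇒length≡ p p-unique p-complete) Fin.zero
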